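{- Let $A\subseteq[N]$ have distinct subset products and be such that $\mathbf{V}_{\mathrm{large}}\times\mathbf{V}_{\mathrm{med}}$ is injective and nonzero on $A$. Suppose the prime factorization graph $G$ of $A$ contains no even circuits of length at most $2N^{1/12}$. Then the set of vertices of $G$ lying in $\mathcal{P}_{\mathrm{large}}$ and having degree at least $2$ has size at most $(1+O(N^{ -1/12+o(1)}))\pi(N^{1/2})$, i.e. for every $\varepsilon>0$ there is $C_\varepsilon$ (independent of $N,A$) such that this size is at most $(1+C_\varepsilon N^{ -1/12+\varepsilon})\pi(N^{1/2})$.
   Context: A finite set $A\subset\mathbb{N}$ has distinct subset products if for any two distinct subsets $B,C\subseteq A$, $\prod_{b\in B}b\neq\prod_{c\in C}c$. $\pi(x)$ is the number of primes $\le x$. Fix $N$; $\mathcal{P}_{\mathrm{med}}$ is the set of primes in $(N^{1/3},N^{1/2}]$, $\mathcal{P}_{\mathrm{large}}$ the set of primes in $(N^{1/2},N]$. $V_p(n)$ is the exponent of the prime $p$ in $n$, and $(\mathbf{V}_{\mathrm{large}}\times\mathbf{V}_{\mathrm{med}})(n)=(V_p(n))_{p\in\mathcal{P}_{\mathrm{large}}\cup\mathcal{P}_{\mathrm{med}}}$. The prime factorization graph $G(A)$ is the simple graph with vertex set $\mathcal{P}_{\mathrm{large}}\cup\mathcal{P}_{\mathrm{med}}\cup\{1\}$, in which $1$ is joined to $p\in\mathcal{P}_{\mathrm{large}}\cup\mathcal{P}_{\mathrm{med}}$ if some $a\in A$ has $V_p(a)=1$ and $V_q(a)=0$ for all other $q\in\mathcal{P}_{\mathrm{large}}\cup\mathcal{P}_{\mathrm{med}}$,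 and distinct $p,q\in\mathcal{P}_{\mathrm{large}}\cup\mathcal{P}_{\mathrm{med}}$ are joined if some element of $A$ is divisible by both $p$ and $q$. A circuit of length $k$ is a collection of edges $\{\{v_1,v_2\},\dots,\{v_{k-1},v_k\},\{v_k,v_1\}\}$ with $v_1,\dots,v_k$ not necessarily distinct; it is even if $k$ is even. -}

module Defs where

open import Data.Nat using (ℕ; zero; suc; _+_; _*_; _∸_; _^_; _≤_; _<_; _/_; _%_; _≟_; _≤?_)
open import Data.Nat.Divisibility using (_∣_; _∣?_)
open import Data.Nat.Primality using (Prime; prime?)
open import Data.Fin using (Fin; toℕ)
open import Data.Fin.Subset using (Subset; Side; inside; outside)
open import Data.Vec using (Vec; []; _∷_)
open import Data.List using (List; length; filter; upTo)
open import Data.List.Relation.Unary.All using (All)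
open import Data.List.Relation.Unary.Unique.Propositional using (Unique)
open import Data.Product using (_×_; ∃; ∃-syntax; _,_)
open import Data.Sum using (_⊎_)
open import Relation.Nullary using (¬_; yes; no)
open import Relation.Nullary.Decidable using (_×-dec_)
open import Relation.Binary.PropositionalEquality using (_≡_; _≢_)

-- p-adic valuation V_p(n): exponent of p in n (for p ≥ 2, n ≥ 1);
-- computed by repeated division, with fuel n (enough since each step divides by p ≥ 2).
-- Conventionally 0 for p ∈ {0,1} or n = 0 (never used there).
V : ℕ → ℕ → ℕ
V zero n = 0
V (suc zero) n = 0
V p@(suc (suc _)) n = go n n
  where
  go : ℕ → ℕ → ℕ
  go zero m = 0
  go (suc f) m with m ≟ 0 | p ∣? m
  ... | yes _ | _ = 0
  ... | no _ | yes _ = suc (go f (m / p))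
  ... | no _ | no _ = 0

Pmed : ℕ → ℕ → Set
Pmed N p = Prime p × (N < p ^ 3) × (p ^ 2 ≤ N)

Plarge : ℕ → ℕ → Set
Plarge N p = Prime p × (N < p ^ 2) × (p ≤ N)

PLM : ℕ → ℕ → Set
PLM N p = Plarge N p ⊎ Pmed N p

prodSub : ∀ {n} → (Fin n → ℕ) → Subset n → ℕ
prodSub {zero} A [] = 1
prodSub {suc n} A (outside ∷ s) = prodSub (λ i → A (Fin.suc i)) s
prodSub {suc n} A (inside ∷ s) = A Fin.zero * prodSub (λ i → A (Fin.suc i)) s

DistinctSubsetProducts : ∀ {n} → (Fin n → ℕ) → Set
DistinctSubsetProducts {n} A = ∀ (B C : Subset n) → B ≢ C → prodSub A B ≢ prodSub A C

-- Edges of the prime factorization graph G(A).  Vertices: P_large ∪ P_med ∪ {1},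
-- the vertex "1" being the natural number 1 (no prime equals 1).
-- edge {1, p}
Edge1 : ℕ → ∀ {n} → (Fin n → ℕ) → ℕ → Set
Edge1 N A p = PLM N p × ∃[ i ] (V p (A i) ≡ 1 × (∀ q → PLM N q → q ≢ p → V q (A i) ≡ 0))

Edge2 : ℕ → ∀ {n} → (Fin n → ℕ) → ℕ → ℕ → Set
Edge2 N A p q = PLM N p × PLM N q × p ≢ q × ∃[ i ] (p ∣ A i × q ∣ A i)

Adj : ℕ → ∀ {n} → (Fin n → ℕ) → ℕ → ℕ → Set
Adj N A u v = (u ≡ 1 × Edge1 N A v) ⊎ (v ≡ 1 × Edge1 N A u) ⊎ Edge2 N A u v

SamePair : ℕ → ℕ → ℕ → ℕ → Set
SamePair a b c d = (a ≡ c × b ≡ d) ⊎ (a ≡ d × b ≡ c)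

-- a circuit of length k = suc m: vertices v 0, …, v m (not necessarily distinct),
-- consecutive (cyclically) adjacent, the k edges {v i, v (i+1 mod k)} being distinct.
Circuit : ℕ → ∀ {n} → (Fin n → ℕ) → (m : ℕ) → (ℕ → ℕ) → Set
Circuit N A m v =
  (∀ i → i < suc m → Adj N A (v i) (v (suc i % suc m))) ×
  (∀ i j → i < suc m → j < suc m → i ≢ j →
     ¬ SamePair (v i) (v (suc i % suc m)) (v j) (v (suc j % suc m)))

-- G(A) has no even circuit of length k with k ≤ 2 N^{1/12}, i.e. k^12 ≤ 2^12 N
NoShortEvenCircuit : ℕ → ∀ {n} → (Fin n → ℕ) → Set
NoShortEvenCircuit N A =
  ∀ m v → Circuit N A m v → ∀ h → suc m ≡ 2 * h → ¬ (suc m ^ 12 ≤ 2 ^ 12 * N)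

LargeDeg2 : ℕ → ∀ {n} → (Fin n → ℕ) → ℕ → Set
LargeDeg2 N A p = Plarge N p × ∃[ u ] ∃[ w ] (u ≢ w × Adj N A p u × Adj N A p w)

piSqrt : ℕ → ℕ
piSqrt N = length (filter (λ p → prime? p ×-dec (p ^ 2 ≤? N)) (upTo (suc N)))

{-# OPTIONS --safe #-}

-- A large prime p of degree ≥ 2 is adjacent in G(A) only to 1 and to medium primes, since two large
-- primes cannot divide the same a ≤ N. Two of its neighbours u, w make p the label of an edge u–w of an
-- auxiliary multigraph H whose vertices {1} ∪ P_med number at most π(N^(1/2)). A closed trail of length ℓ
-- in H is an even circuit of length 2ℓ in G(A), so H has no closed trail of length ≤ 2qk as long as
-- (2qk)^12 ≤ N. Breadth-first search then bounds the number of edges of such a graph: while the edges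
-- touching a ball outnumber its vertices by the factor (q+1)/q the ball grows by that factor, which
-- cannot go on for qk steps once 2^k > π(N^(1/2)); so some ball is sparse, and it can be deleted.
-- Hence q |S| ≤ (q+1) π(N^(1/2)), and q ≈ N^(1/12) / 2k with k ≈ log₂ N gives the theorem.

module Submission where

open import Defs
open import Data.Empty using (⊥; ⊥-elim)
open import Data.Fin using (Fin)
open import Data.List using (List; []; _∷_; length; map; filter; _++_; [_]; upTo)
open import Data.List.Properties using (length-map; length-++; map-++; filter-notAll; length-filter; filter-some; length-upTo)
open import Data.List.Relation.Unary.All as All using (All; []; _∷_)
open import Data.List.Relation.Unary.All.Properties using (++⁺; ¬Any⇒All¬)
open import Data.List.Relation.Unary.Any as Any using (Any; here; there)
open import Data.List.Relation.Unary.Unique.Propositional using (Unique)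
open import Data.List.Relation.Unary.AllPairs using ([]; _∷_)
import Data.List.Relation.Unary.Unique.Propositional.Properties as Unique
open import Data.List.Relation.Binary.Subset.Propositional using (_⊆_)
open import Data.List.Membership.Propositional using (_∈_; _∉_; find; lose)
open import Data.List.Membership.Propositional.Properties using (∈-filter⁺; ∈-filter⁻; ∈-map⁺; ∈-map⁻; ∈-upTo⁺)
open import Data.Nat
open import Data.Nat.Properties
open import Data.Nat.DivMod using (_/_; _%_; m≡m%n+[m/n]*n; m%n<n; m/n*n≤m; m<n⇒m%n≡m; n%n≡0)
open import Data.Nat.Divisibility using (_∣_; divides; ∣⇒≤)
open import Data.Nat.Primality using (Prime; prime?; euclidsLemma; prime⇒irreducible; prime⇒nonTrivial; prime[2])
open import Data.Nat.Tactic.RingSolver using (solve-∀)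
open import Algebra.Properties.CommutativeSemigroup *-commutativeSemigroup using (x∙yz≈y∙xz)
open import Data.List.Membership.DecPropositional _≟_ using (_∈?_)
open import Data.Product using (∃-syntax; _×_; _,_; proj₁; proj₂)
open import Data.Sum using (_⊎_; inj₁; inj₂)
open import Function using (_∘_; Injective)
open import Level using (Level)
open import Relation.Binary.Definitions using (DecidableEquality)
open import Induction.WellFounded using (Acc; acc)
open import Data.Nat.Induction using (<-wellFounded)
open import Relation.Binary.PropositionalEquality hiding ([_])
open import Relation.Nullary using (¬_; Dec; yes; no; ¬?)
open import Relation.Nullary.Decidable using (_×-dec_; _⊎-dec_)
open import Relation.Unary using (Pred; Decidable)
open import Relation.Unary.Properties using (∁?)

private variable
  a p : Level
  A B : Set a

length-filter-∁ : {P : Pred A p} (P? : Decidable P) (xs : List A) →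
  length (filter P? xs) + length (filter (∁? P?) xs) ≡ length xs
length-filter-∁ P? [] = refl
length-filter-∁ P? (x ∷ xs) with P? x
... | yes _ = cong suc (length-filter-∁ P? xs)
... | no _ = trans (+-suc _ _) (cong suc (length-filter-∁ P? xs))

module _ (_≟_ : DecidableEquality A) where

  Unique⇒length-mono : {xs ys : List A} → Unique xs → xs ⊆ ys → length xs ≤ length ys
  Unique⇒length-mono {xs = []} _ _ = z≤n
  Unique⇒length-mono {xs = x ∷ xs} {ys} (x≢xs ∷ u) x∷xs⊆ys = begin-strict
    length xs                            ≤⟨ Unique⇒length-mono u xs⊆others ⟩
    length (filter (¬? ∘ (_≟ x)) ys)     <⟨ filter-notAll (¬? ∘ (_≟ x)) ys (Any.map (λ x≡y y≢x → y≢x (sym x≡y)) (x∷xs⊆ys (here refl))) ⟩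
    length ys                            ∎
    where
    open ≤-Reasoning
    xs⊆others : xs ⊆ filter (¬? ∘ (_≟ x)) ys
    xs⊆others y∈xs = ∈-filter⁺ (¬? ∘ (_≟ x)) (x∷xs⊆ys (there y∈xs)) (λ y≡x → All.lookup x≢xs y∈xs (sym y≡x))

Unique-map⁺-on : (f : A → B) {xs : List A} → (∀ {x y} → x ∈ xs → y ∈ xs → f x ≡ f y → x ≡ y) →
  Unique xs → Unique (map f xs)
Unique-map⁺-on f {[]} _ [] = []
Unique-map⁺-on f {x ∷ xs} inj (x∉ ∷ u) =
  All.tabulate fresh ∷ Unique-map⁺-on f (λ y∈ z∈ → inj (there y∈) (there z∈)) u
  where
  fresh : ∀ {z} → z ∈ map f xs → f x ≢ z
  fresh z∈ fx≡z with ∈-map⁻ f z∈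
  ... | y , y∈ , refl = All.lookup x∉ y∈ (inj (here refl) (there y∈) fx≡z)

Unique-map⇒injective : (f : A → B) {xs : List A} → Unique (map f xs) →
  ∀ {x y} → x ∈ xs → y ∈ xs → f x ≡ f y → x ≡ y
Unique-map⇒injective f u (here refl) (here refl) _ = refl
Unique-map⇒injective f (fx∉ ∷ _) (here refl) (there y∈xs) fx≡fy = ⊥-elim (All.lookup fx∉ (∈-map⁺ f y∈xs) fx≡fy)
Unique-map⇒injective f (fy∉ ∷ _) (there x∈xs) (here refl) fx≡fy = ⊥-elim (All.lookup fy∉ (∈-map⁺ f x∈xs) (sym fx≡fy))
Unique-map⇒injective f (_ ∷ u) (there x∈xs) (there y∈xs) fx≡fy = Unique-map⇒injective f u x∈xs y∈xs fx≡fy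

-- the least i ≤ K satisfying P, and suc K if there is none
least : {P : Pred ℕ p} → Decidable P → ℕ → ℕ
least P? K with P? 0
least P? K | yes _ = 0
least P? zero | no _ = 1
least P? (suc K) | no _ = suc (least (P? ∘ suc) K)

least-≤ : {P : Pred ℕ p} (P? : Decidable P) (K : ℕ) {j : ℕ} → P j → j ≤ K → least P? K ≤ j
least-≤ P? K {j} Pj j≤K with P? 0
least-≤ P? K {j} Pj j≤K | yes _ = z≤n
least-≤ P? K {zero} Pj j≤K | no ¬P0 = ⊥-elim (¬P0 Pj)
least-≤ P? (suc K) {suc j} Pj (s≤s j≤K) | no _ = s≤s (least-≤ (P? ∘ suc) K Pj j≤K)

least-satisfies : {P : Pred ℕ p} (P? : Decidable P) (K : ℕ) → least P? K ≤ K → P (least P? K)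
least-satisfies P? K le with P? 0
least-satisfies P? K le | yes P0 = P0
least-satisfies P? (suc K) (s≤s le) | no _ = least-satisfies (P? ∘ suc) K le

crossing : (f : ℕ → ℕ) {N : ℕ} (M : ℕ) → f 0 ≤ N → N < f M → ∃[ q ] f q ≤ N × N < f (suc q)
crossing f zero f0≤N N<f0 = ⊥-elim (<⇒≱ N<f0 f0≤N)
crossing f {N} (suc M) f0≤N N<fM with f M ≤? N
... | yes fM≤N = M , fM≤N , N<fM
... | no fM≰N = crossing f M f0≤N (≰⇒> fM≰N)

interleave : (ℕ → A) → (ℕ → A) → ℕ → A
interleave f g zero = f 0
interleave f g (suc zero) = g 0
interleave f g (suc (suc i)) = interleave (f ∘ suc) (g ∘ suc) i

interleave-even : (f g : ℕ → A) (j : ℕ) → interleave f g (j + j) ≡ f j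
interleave-even f g zero = refl
interleave-even f g (suc j) rewrite +-suc j j = interleave-even (f ∘ suc) (g ∘ suc) j

interleave-odd : (f g : ℕ → A) (j : ℕ) → interleave f g (suc (j + j)) ≡ g j
interleave-odd f g zero = refl
interleave-odd f g (suc j) rewrite +-suc j j = interleave-odd (f ∘ suc) (g ∘ suc) j

even⊎odd : (i : ℕ) → ∃[ j ] (i ≡ j + j ⊎ i ≡ suc (j + j))
even⊎odd zero = 0 , inj₁ refl
even⊎odd (suc i) with even⊎odd i
... | j , inj₁ refl = j , inj₂ refl
... | j , inj₂ refl = suc j , inj₁ (cong suc (sym (+-suc j j)))

-- Multigraphs with labelled edges

record Edge : Set where
  constructor edge
  field
    label src dst : ℕ

open Edge

opposite : Edge → Edge
opposite e = edge (label e) (dst e) (src e)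

_∈ᵘ_ : Edge → List Edge → Set
s ∈ᵘ Es = s ∈ Es ⊎ opposite s ∈ Es

opposite-∈ᵘ : ∀ {Es s} → s ∈ᵘ Es → opposite s ∈ᵘ Es
opposite-∈ᵘ (inj₁ s∈) = inj₂ s∈
opposite-∈ᵘ (inj₂ s∈) = inj₁ s∈

LabelsIdentify : List Edge → Set
LabelsIdentify Es = ∀ {e e′} → e ∈ Es → e′ ∈ Es → label e ≡ label e′ → e ≡ e′

SameEnds : Edge → Edge → Set
SameEnds s t = (src s ≡ src t × dst s ≡ dst t) ⊎ (src s ≡ dst t × dst s ≡ src t)

same-label⇒same-ends : ∀ {Es} → LabelsIdentify Es → ∀ {s t} → s ∈ᵘ Es → t ∈ᵘ Es → label s ≡ label t → SameEnds s t
same-label⇒same-ends li (inj₁ s∈) (inj₁ t∈) eq with li s∈ t∈ eq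
... | refl = inj₁ (refl , refl)
same-label⇒same-ends li (inj₁ s∈) (inj₂ t∈) eq with li s∈ t∈ eq
... | refl = inj₂ (refl , refl)
same-label⇒same-ends li (inj₂ s∈) (inj₁ t∈) eq with li s∈ t∈ eq
... | refl = inj₂ (refl , refl)
same-label⇒same-ends li (inj₂ s∈) (inj₂ t∈) eq with li s∈ t∈ eq
... | refl = inj₁ (refl , refl)

Walk : ℕ → List Edge → ℕ → Set
Walk x [] z = x ≡ z
Walk x (s ∷ ss) z = src s ≡ x × Walk (dst s) ss z

vertices : ℕ → List Edge → List ℕ
vertices x ss = x ∷ map dst ss

walk-++ : ∀ {x y z} ss ts → Walk x ss y → Walk y ts z → Walk x (ss ++ ts) z
walk-++ [] ts refl w = w
walk-++ (s ∷ ss) ts (src≡x , w) w′ = src≡x , walk-++ ss ts w w′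

backwards : List Edge → List Edge
backwards [] = []
backwards (s ∷ ss) = backwards ss ++ [ opposite s ]

walk-backwards : ∀ {x z} ss → Walk x ss z → Walk z (backwards ss) x
walk-backwards [] refl = refl
walk-backwards (s ∷ ss) (src≡x , w) = walk-++ (backwards ss) _ (walk-backwards ss w) (refl , src≡x)

All-backwards : {P : Edge → Set} → (∀ {s} → P s → P (opposite s)) → ∀ {ss} → All P ss → All P (backwards ss)
All-backwards P-opp [] = []
All-backwards P-opp (Ps ∷ Pss) = ++⁺ (All-backwards P-opp Pss) (P-opp Ps ∷ [])

length-backwards : ∀ ss → length (backwards ss) ≡ length ss
length-backwards [] = refl
length-backwards (s ∷ ss) = trans (length-++ (backwards ss)) (trans (+-comm _ 1) (cong suc (length-backwards ss)))

walk-endpoints : ∀ {x z} ss → Walk x ss z → ∀ {s} → s ∈ ss → src s ∈ vertices x ss × dst s ∈ vertices x ss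
walk-endpoints (s ∷ ss) (src≡x , w) (here refl) = here src≡x , there (here refl)
walk-endpoints (s ∷ ss) (src≡x , w) (there s∈) = Data.Product.map there there (walk-endpoints ss w s∈)

Path : ℕ → List Edge → ℕ → Set
Path x ps z = Walk x ps z × Unique (vertices x ps)

path-suffix : ∀ {b x z} ps → Path b ps z → x ∈ vertices b ps →
  ∃[ qs ] Path x qs z × qs ⊆ ps × length qs ≤ length ps
path-suffix ps path (here refl) = ps , path , (λ q∈ → q∈) , ≤-refl
path-suffix (t ∷ ps) ((_ , w) , _ ∷ u) (there x∈) with path-suffix ps (w , u) x∈
... | qs , path′ , qs⊆ps , len = qs , path′ , there ∘ qs⊆ps , m≤n⇒m≤1+n len

walk⇒path : ∀ {x z} ss → Walk x ss z → ∃[ ps ] Path x ps z × ps ⊆ ss × length ps ≤ length ss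
walk⇒path [] refl = [] , (refl , [] ∷ []) , (λ ()) , z≤n
walk⇒path {x} (s ∷ ss) (src≡x , w) with walk⇒path ss w
... | ps , (w′ , u) , ps⊆ss , len with x ∈? vertices (dst s) ps
...   | yes x∈ with path-suffix ps (w′ , u) x∈
...     | qs , path , qs⊆ps , len′ = qs , path , there ∘ ps⊆ss ∘ qs⊆ps , m≤n⇒m≤1+n (≤-trans len′ len)
walk⇒path {x} (s ∷ ss) (src≡x , w) | ps , (w′ , u) , ps⊆ss , len | no x∉ =
  s ∷ ps , ((src≡x , w′) , ¬Any⇒All¬ _ x∉ ∷ u) , ∷⊆ , s≤s len
  where
  ∷⊆ : s ∷ ps ⊆ s ∷ ss
  ∷⊆ (here refl) = here refl
  ∷⊆ (there t∈) = there (ps⊆ss t∈)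

path-labels-distinct : ∀ {Es} → LabelsIdentify Es → ∀ {x z} ps → Path x ps z → All (_∈ᵘ Es) ps → Unique (map label ps)
path-labels-distinct li [] _ [] = []
path-labels-distinct li {x} (s ∷ ps) ((src≡x , w) , x∉ ∷ u) (s∈ ∷ ps∈) =
  ¬Any⇒All¬ _ label-new ∷ path-labels-distinct li ps (w , u) ps∈
  where
  label-new : label s ∉ map label ps
  label-new ℓ∈ with ∈-map⁻ label ℓ∈
  ... | t , t∈ , eq with walk-endpoints ps w t∈ | same-label⇒same-ends li s∈ (All.lookup ps∈ t∈) eq
  ... | src∈ , _ | inj₁ (src≡ , _) = All.lookup x∉ (subst (_∈ _) (trans (sym src≡) src≡x) src∈) refl
  ... | _ , dst∈ | inj₂ (src≡ , _) = All.lookup x∉ (subst (_∈ _) (trans (sym src≡) src≡x) dst∈) refl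

record ClosedTrail (Es ss : List Edge) : Set where
  field
    base : ℕ
    closed : Walk base ss base
    along : All (_∈ᵘ Es) ss
    labels-distinct : Unique (map label ss)
    nonempty : 1 ≤ length ss

ClosedTrailsLongerThan : ℕ → List Edge → Set
ClosedTrailsLongerThan L Es = ∀ {ss} → ClosedTrail Es ss → L < length ss

close-into-trail : ∀ {Es} → LabelsIdentify Es → ∀ {t} → t ∈ᵘ Es → ∀ ss → Walk (dst t) ss (src t) →
  All (_∈ᵘ Es) ss → All ((_≢ label t) ∘ label) ss → ∃[ ts ] ClosedTrail Es ts × length ts ≤ suc (length ss)
close-into-trail {Es} li {t} t∈ ss w ss∈ avoid-t with walk⇒path ss w
... | ps , (w′ , u) , ps⊆ss , len = ps ++ [ t ] , trail , length-closing
  where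
  ps∈ : All (_∈ᵘ Es) ps
  ps∈ = All.tabulate (All.lookup ss∈ ∘ ps⊆ss)
  t-fresh : ∀ {ℓ} → ℓ ∈ map label ps × ℓ ∈ [ label t ] → ⊥
  t-fresh (ℓ∈ , here refl) with ∈-map⁻ label ℓ∈
  ... | s , s∈ , eq = All.lookup avoid-t (ps⊆ss s∈) (sym eq)
  trail : ClosedTrail Es (ps ++ [ t ])
  trail = record
    { base = dst t
    ; closed = walk-++ ps [ t ] w′ (refl , refl)
    ; along = ++⁺ ps∈ (t∈ ∷ [])
    ; labels-distinct = subst Unique (sym (map-++ label ps [ t ]))
        (Unique.++⁺ (path-labels-distinct li ps (w′ , u) ps∈) ([] ∷ []) t-fresh)
    ; nonempty = subst (1 ≤_) (sym (length-++ ps)) (m≤n+m 1 (length ps))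
    }
  length-closing : length (ps ++ [ t ]) ≤ suc (length ss)
  length-closing = subst (_≤ suc (length ss)) (sym (trans (length-++ ps) (+-comm (length ps) 1))) (s≤s len)

ClosedTrail-mono : ∀ {Es Fs} → Es ⊆ Fs → ∀ {ss} → ClosedTrail Es ss → ClosedTrail Fs ss
ClosedTrail-mono Es⊆Fs record { base = x ; closed = w ; along = ss∈ ; labels-distinct = u ; nonempty = ne } =
  record { base = x ; closed = w ; along = All.map (Data.Sum.map Es⊆Fs Es⊆Fs) ss∈ ; labels-distinct = u ; nonempty = ne }

different-ends⇒different-labels : ∀ {Es} → LabelsIdentify Es → ∀ {s t} → s ∈ᵘ Es → t ∈ᵘ Es →
  src s ≢ dst t → dst s ≢ dst t → label s ≢ label t
different-ends⇒different-labels li s∈ t∈ src≢ dst≢ eq with same-label⇒same-ends li s∈ t∈ eq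
... | inj₁ (_ , dst≡) = dst≢ dst≡
... | inj₂ (src≡ , _) = src≢ src≡

Incident : Pred ℕ p → Edge → Set p
Incident P e = P (src e) ⊎ P (dst e)

incident? : {P : Pred ℕ p} → Decidable P → Decidable (Incident P)
incident? P? e = P? (src e) ⊎-dec P? (dst e)

record IsMultigraph (Vs : List ℕ) (Es : List Edge) : Set where
  field
    vertices-distinct : Unique Vs
    endpoints : ∀ {e} → e ∈ Es → src e ∈ Vs × dst e ∈ Vs
    loopless : ∀ {e} → e ∈ Es → src e ≢ dst e
    labels-distinct : Unique (map label Es)

delete-vertices : ∀ {Vs Es} {P : Pred ℕ p} (P? : Decidable P) → IsMultigraph Vs Es →
  IsMultigraph (filter (∁? P?) Vs) (filter (∁? (incident? P?)) Es)
delete-vertices {Vs = Vs} {Es} P? G = record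
  { vertices-distinct = Unique.filter⁺ (∁? P?) vertices-distinct
  ; endpoints = λ e∈ → let ¬incident = proj₂ (∈-filter⁻ (∁? (incident? P?)) {xs = Es} e∈) in
      ∈-filter⁺ (∁? P?) (proj₁ (endpoints (kept e∈))) (¬incident ∘ inj₁) ,
      ∈-filter⁺ (∁? P?) (proj₂ (endpoints (kept e∈))) (¬incident ∘ inj₂)
  ; loopless = loopless ∘ kept
  ; labels-distinct = Unique-map⁺-on label
      (λ e∈ e′∈ → Unique-map⇒injective label labels-distinct (kept e∈) (kept e′∈))
      (Unique.filter⁺ (∁? (incident? P?)) (Unique.map⁻ labels-distinct))
  }
  where
  open IsMultigraph G
  kept : ∀ {e} → e ∈ filter (∁? (incident? P?)) Es → e ∈ Es
  kept e∈ = proj₁ (∈-filter⁻ (∁? (incident? P?)) {xs = Es} e∈)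

-- Balls around a vertex and a Moore-type bound

module Balls (Es : List Edge) (v K : ℕ) where

  Reach : ℕ → ℕ → Set
  Reach zero x = v ≡ x
  Reach (suc i) x = Reach i x ⊎ Any (λ e → (src e ≡ x × Reach i (dst e)) ⊎ (dst e ≡ x × Reach i (src e))) Es

  reach? : ∀ i → Decidable (Reach i)
  reach? zero x = v ≟ x
  reach? (suc i) x = reach? i x ⊎-dec Any.any? (λ e → (src e ≟ x ×-dec reach? i (dst e)) ⊎-dec (dst e ≟ x ×-dec reach? i (src e))) Es

  reach-mono : ∀ {i j x} → i ≤ j → Reach i x → Reach j x
  reach-mono {j = zero} z≤n r = r
  reach-mono {i} {suc j} i≤1+j r with m≤n⇒m<n∨m≡n i≤1+j
  ... | inj₁ (s≤s i≤j) = inj₁ (reach-mono i≤j r)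
  ... | inj₂ refl = r

  reach-center : ∀ i → Reach i v
  reach-center i = reach-mono z≤n refl

  reach-step : ∀ {i s} → s ∈ᵘ Es → Reach i (dst s) → Reach (suc i) (src s)
  reach-step (inj₁ s∈) r = inj₂ (lose s∈ (inj₁ (refl , r)))
  reach-step (inj₂ s∈) r = inj₂ (lose s∈ (inj₂ (refl , r)))

  reach-unstep : ∀ {i x} → Reach (suc i) x → Reach i x ⊎ ∃[ s ] s ∈ᵘ Es × src s ≡ x × Reach i (dst s)
  reach-unstep (inj₁ r) = inj₁ r
  reach-unstep (inj₂ any) with find any
  ... | e , e∈ , inj₁ (src≡x , r) = inj₂ (e , inj₁ e∈ , src≡x , r)
  ... | e , e∈ , inj₂ (dst≡x , r) = inj₂ (opposite e , inj₂ e∈ , dst≡x , r)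

  -- the distance from v, truncated at suc K
  level : ℕ → ℕ
  level x = least (λ i → reach? i x) K

  level-≤ : ∀ {j x} → Reach j x → j ≤ K → level x ≤ j
  level-≤ {x = x} r j≤K = least-≤ (λ i → reach? i x) K r j≤K

  reach-level : ∀ {j x} → level x ≤ j → j ≤ K → Reach j x
  reach-level {x = x} lx≤j j≤K = reach-mono lx≤j (least-satisfies (λ i → reach? i x) K (≤-trans lx≤j j≤K))

  Descending : Edge → Set
  Descending s = level (dst s) < level (src s)

  descent : ∀ {j x} → j ≤ K → Reach j x →
    ∃[ ss ] Walk x ss v × length ss ≤ j × All (_∈ᵘ Es) ss × All Descending ss
  descent {zero} _ refl = [] , refl , z≤n , [] , []
  descent {suc j} {x} 1+j≤K r with reach? j x
  ... | yes r′ with descent (<⇒≤ 1+j≤K) r′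
  ...   | ss , w , len , ss∈ , ds = ss , w , m≤n⇒m≤1+n len , ss∈ , ds
  descent {suc j} {x} 1+j≤K r | no ¬r′ with reach-unstep r
  ...   | inj₁ r′ = ⊥-elim (¬r′ r′)
  ...   | inj₂ (s , s∈ , src≡x , r′) with descent (<⇒≤ 1+j≤K) r′
  ...     | ss , w , len , ss∈ , ds = s ∷ ss , (src≡x , w) , s≤s len , s∈ ∷ ss∈ , descends ∷ ds
    where
    j<level : j < level x
    j<level = ≰⇒> λ lx≤j → ¬r′ (reach-level lx≤j (<⇒≤ 1+j≤K))
    descends : Descending s
    descends = subst (λ u → level (dst s) < level u) (sym src≡x)
                 (≤-<-trans (level-≤ r′ (<⇒≤ 1+j≤K)) j<level)

  Avoids : ℕ → Edge → Set
  Avoids y s = src s ≢ y × dst s ≢ y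

  descending-avoids : ∀ {x y z} ss → Walk x ss z → All Descending ss → level x ≤ level y → x ≢ y → All (Avoids y) ss
  descending-avoids [] _ _ _ _ = []
  descending-avoids {x} {y} (s ∷ ss) (src≡x , w) (d ∷ ds) lx≤ly x≢y =
    (x≢y ∘ trans (sym src≡x) , dst≢y) ∷ descending-avoids ss w ds (<⇒≤ ld<ly) dst≢y
    where
    ld<ly : level (dst s) < level y
    ld<ly = <-≤-trans (subst (λ u → level (dst s) < level u) src≡x d) lx≤ly
    dst≢y : dst s ≢ y
    dst≢y refl = <-irrefl refl ld<ly

  outward : Edge → Edge
  outward e with level (src e) ≤? level (dst e)
  ... | yes _ = e
  ... | no _ = opposite e

  near far : Edge → ℕ
  near e = src (outward e)
  far e = dst (outward e)

  near-lowest : ∀ e → level (near e) ≤ level (src e) × level (near e) ≤ level (dst e)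
  near-lowest e with level (src e) ≤? level (dst e)
  ... | yes ls≤ld = ≤-refl , ls≤ld
  ... | no ls≰ld = <⇒≤ (≰⇒> ls≰ld) , ≤-refl

  near≤far : ∀ e → level (near e) ≤ level (far e)
  near≤far e with level (src e) ≤? level (dst e)
  ... | yes ls≤ld = ls≤ld
  ... | no ls≰ld = <⇒≤ (≰⇒> ls≰ld)

  outward-∈ᵘ : ∀ {e} → e ∈ Es → outward e ∈ᵘ Es
  outward-∈ᵘ {e} e∈ with level (src e) ≤? level (dst e)
  ... | yes _ = inj₁ e∈
  ... | no _ = inj₂ e∈

  outward-label : ∀ e → label (outward e) ≡ label e
  outward-label e with level (src e) ≤? level (dst e)
  ... | yes _ = refl
  ... | no _ = refl

  near≢far : ∀ {e} → src e ≢ dst e → near e ≢ far e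
  near≢far {e} src≢dst with level (src e) ≤? level (dst e)
  ... | yes _ = src≢dst
  ... | no _ = src≢dst ∘ sym

  Touches : ℕ → Edge → Set
  Touches i = Incident (Reach i)

  touches? : ∀ i → Decidable (Touches i)
  touches? i = incident? (reach? i)

  touches⇒reach-near : ∀ {i e} → i ≤ K → Touches i e → Reach i (near e)
  touches⇒reach-near {e = e} i≤K (inj₁ r) = reach-level (≤-trans (proj₁ (near-lowest e)) (level-≤ r i≤K)) i≤K
  touches⇒reach-near {e = e} i≤K (inj₂ r) = reach-level (≤-trans (proj₂ (near-lowest e)) (level-≤ r i≤K)) i≤K

  touches⇒reach-far : ∀ {i e} → i ≤ K → e ∈ Es → Touches i e → Reach (suc i) (far e)
  touches⇒reach-far i≤K e∈ te = reach-step (opposite-∈ᵘ (outward-∈ᵘ e∈)) (touches⇒reach-near i≤K te)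

  far≢center : ∀ {e} → src e ≢ dst e → far e ≢ v
  far≢center {e} src≢dst far≡v = near≢far src≢dst (trans (sym near-is-v) (sym far≡v))
    where
    near-is-v : v ≡ near e
    near-is-v = reach-level {j = 0} (≤-trans (near≤far e) (subst (λ u → level u ≤ 0) (sym far≡v) (level-≤ {0} refl z≤n))) z≤n

  inward-walk : ∀ {i e} → i ≤ K → src e ≢ dst e → Touches i e →
    ∃[ ss ] Walk (near e) ss v × length ss ≤ i × All (λ s → s ∈ᵘ Es × Avoids (far e) s) ss
  inward-walk {e = e} i≤K src≢dst te with descent i≤K (touches⇒reach-near i≤K te)
  ... | ss , w , len , ss∈ , ds =
    ss , w , len , All.zip (ss∈ , descending-avoids ss w ds (near≤far e) (near≢far src≢dst))

  module _ (labels-identify : LabelsIdentify Es) (loopless : ∀ {e} → e ∈ Es → src e ≢ dst e)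
           (girth : ClosedTrailsLongerThan (K + K) Es) where

    -- two edges meeting at their far end close up, through v, into a short closed trail
    meeting-edges-close : ∀ {i e e′} → suc i ≤ K → e ∈ Es → e′ ∈ Es → Touches i e → Touches i e′ →
      far e ≡ far e′ → label e ≢ label e′ → ∃[ ts ] ClosedTrail Es ts × length ts ≤ K + K
    meeting-edges-close {i} {e} {e′} 1+i≤K e∈ e′∈ te te′ same-far neq
      with inward-walk (<⇒≤ 1+i≤K) (loopless e∈) te | inward-walk (<⇒≤ 1+i≤K) (loopless e′∈) te′
    ... | D , wD , lenD , D∈ | D′ , wD′ , lenD′ , D′∈
      with close-into-trail labels-identify (opposite-∈ᵘ (outward-∈ᵘ e∈)) P walk P∈ P-avoids
      where
      P = D ++ backwards D′ ++ [ outward e′ ]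
      walk : Walk (near e) P (far e)
      walk = walk-++ D _ wD (walk-++ (backwards D′) [ outward e′ ] (walk-backwards D′ wD′) (refl , sym same-far))
      D′∈′ : All (λ s → s ∈ᵘ Es × Avoids (far e) s) D′
      D′∈′ = subst (λ y → All (λ s → s ∈ᵘ Es × Avoids y s) D′) (sym same-far) D′∈
      P∈ : All (_∈ᵘ Es) P
      P∈ = ++⁺ (All.map proj₁ D∈) (++⁺ (All-backwards opposite-∈ᵘ (All.map proj₁ D′∈)) (outward-∈ᵘ e′∈ ∷ []))
      avoids⇒other-label : ∀ {s} → s ∈ᵘ Es × Avoids (far e) s → label s ≢ label (outward e)
      avoids⇒other-label (s∈ , src≢ , dst≢) = different-ends⇒different-labels labels-identify s∈ (outward-∈ᵘ e∈) src≢ dst≢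
      P-avoids : All ((_≢ label (outward e)) ∘ label) P
      P-avoids = ++⁺ (All.map avoids⇒other-label D∈)
                 (++⁺ (All.map avoids⇒other-label (All-backwards (λ (s∈ , src≢ , dst≢) → opposite-∈ᵘ s∈ , dst≢ , src≢) D′∈′))
                      ((λ eq → neq (trans (sym (outward-label e)) (trans (sym eq) (outward-label e′)))) ∷ []))
    ... | ts , trail , len = ts , trail , ≤-trans len (begin
      suc (length (D ++ backwards D′ ++ [ outward e′ ]))    ≡⟨ cong suc (length-++ D) ⟩
      suc (length D + length (backwards D′ ++ [ outward e′ ])) ≡⟨ cong (λ n → suc (length D + n)) (length-++ (backwards D′)) ⟩
      suc (length D + (length (backwards D′) + 1))            ≡⟨ cong (λ n → suc (length D + n)) (+-comm _ 1) ⟩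
      suc (length D + suc (length (backwards D′)))            ≡⟨ cong (λ n → suc (length D + suc n)) (length-backwards D′) ⟩
      suc (length D + suc (length D′))                        ≤⟨ s≤s (+-mono-≤ lenD (s≤s lenD′)) ⟩
      suc i + suc i                                           ≤⟨ +-mono-≤ 1+i≤K 1+i≤K ⟩
      K + K                                                   ∎)
      where open ≤-Reasoning

    far-injective : ∀ {i e e′} → suc i ≤ K → e ∈ Es → e′ ∈ Es → Touches i e → Touches i e′ →
      far e ≡ far e′ → e ≡ e′
    far-injective {e = e} {e′} 1+i≤K e∈ e′∈ te te′ same-far with label e ≟ label e′
    ... | yes eq = labels-identify e∈ e′∈ eq
    ... | no neq with meeting-edges-close 1+i≤K e∈ e′∈ te te′ same-far neq
    ...   | _ , trail , len = ⊥-elim (<⇒≱ (girth trail) len)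

    ball-growth : ∀ {Vs} → (∀ {e} → e ∈ Es → src e ∈ Vs × dst e ∈ Vs) → v ∈ Vs → Unique Es →
      ∀ {i} → suc i ≤ K → suc (length (filter (touches? i) Es)) ≤ length (filter (reach? (suc i)) Vs)
    ball-growth {Vs} ends v∈ unique-Es {i} 1+i≤K =
      subst (_≤ length (filter (reach? (suc i)) Vs)) (cong suc (length-map far F))
        (Unique⇒length-mono _≟_ unique ⊆ball)
      where
      i≤K = <⇒≤ 1+i≤K
      F = filter (touches? i) Es
      far-injective-on-F : ∀ {e e′} → e ∈ F → e′ ∈ F → far e ≡ far e′ → e ≡ e′
      far-injective-on-F e∈F e′∈F with ∈-filter⁻ (touches? i) e∈F | ∈-filter⁻ (touches? i) e′∈F
      ... | e∈ , te | e′∈ , te′ = far-injective 1+i≤K e∈ e′∈ te te′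
      v-fresh : All (v ≢_) (map far F)
      v-fresh = All.tabulate λ u∈ v≡u → let e , e∈F , u≡far = ∈-map⁻ far u∈ in
        far≢center (loopless (proj₁ (∈-filter⁻ (touches? i) e∈F))) (sym (trans v≡u u≡far))
      unique : Unique (v ∷ map far F)
      unique = v-fresh ∷ Unique-map⁺-on far far-injective-on-F (Unique.filter⁺ (touches? i) unique-Es)
      far∈Vs : ∀ e → e ∈ Es → far e ∈ Vs
      far∈Vs e e∈ with level (src e) ≤? level (dst e)
      ... | yes _ = proj₂ (ends e∈)
      ... | no _ = proj₁ (ends e∈)
      ⊆ball : v ∷ map far F ⊆ filter (reach? (suc i)) Vs
      ⊆ball (here refl) = ∈-filter⁺ (reach? (suc i)) v∈ (reach-center (suc i))
      ⊆ball (there u∈) with ∈-map⁻ far u∈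
      ... | e , e∈F , refl with ∈-filter⁻ (touches? i) e∈F
      ...   | e∈ , te = ∈-filter⁺ (reach? (suc i)) (far∈Vs e e∈) (touches⇒reach-far i≤K e∈ te)

geometric-step : ∀ q i {b f b′} → suc q ^ i ≤ q ^ i * b → suc q * b < q * f → suc f ≤ b′ →
  suc q ^ suc i ≤ q ^ suc i * b′
geometric-step q i {b} {f} {b′} grown dense f<b′ = begin
  suc q * suc q ^ i    ≤⟨ *-monoʳ-≤ (suc q) grown ⟩
  suc q * (q ^ i * b)  ≡⟨ x∙yz≈y∙xz (suc q) (q ^ i) b ⟩
  q ^ i * (suc q * b)  ≤⟨ *-monoʳ-≤ (q ^ i) (<⇒≤ dense) ⟩
  q ^ i * (q * f)      ≤⟨ *-monoʳ-≤ (q ^ i) (*-monoʳ-≤ q (<⇒≤ f<b′)) ⟩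
  q ^ i * (q * b′)     ≡⟨ x∙yz≈y∙xz (q ^ i) q b′ ⟩
  q * (q ^ i * b′)     ≡⟨ *-assoc q (q ^ i) b′ ⟨
  q * q ^ i * b′       ∎
  where open ≤-Reasoning

module _ (q r : ℕ) {Vs Es} (G : IsMultigraph Vs Es) (girth : ClosedTrailsLongerThan (r + r) Es) {v : ℕ} (v∈ : v ∈ Vs) where

  open IsMultigraph G
  open Balls Es v r

  sparse-or-growing : ∀ i → i ≤ r → (∃[ j ] q * length (filter (touches? j) Es) ≤ suc q * length (filter (reach? j) Vs))
                                    ⊎ suc q ^ i ≤ q ^ i * length (filter (reach? i) Vs)
  sparse-or-growing zero _ = inj₂ (≤-trans (filter-some (reach? 0) (lose v∈ refl)) (≤-reflexive (sym (+-identityʳ _))))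
  sparse-or-growing (suc i) 1+i≤r with sparse-or-growing i (<⇒≤ 1+i≤r)
  ... | inj₁ sparse = inj₁ sparse
  ... | inj₂ grown with q * length (filter (touches? i) Es) ≤? suc q * length (filter (reach? i) Vs)
  ...   | yes sparse = inj₁ (i , sparse)
  ...   | no dense = inj₂ (geometric-step q i grown (≰⇒> dense)
             (ball-growth (Unique-map⇒injective label labels-distinct) loopless girth endpoints v∈
                          (Unique.map⁻ labels-distinct) 1+i≤r))

  sparse-ball : q ^ r * length Vs < suc q ^ r →
    ∃[ j ] q * length (filter (touches? j) Es) ≤ suc q * length (filter (reach? j) Vs)
  sparse-ball small with sparse-or-growing r ≤-refl
  ... | inj₁ sparse = sparse
  ... | inj₂ grown = ⊥-elim (<⇒≱ small (≤-trans grown (*-monoʳ-≤ (q ^ r) (length-filter (reach? r) Vs))))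

edge-bound-acc : ∀ q r {Vs Es} → Acc _<_ (length Vs) → IsMultigraph Vs Es → ClosedTrailsLongerThan (r + r) Es →
  q ^ r * length Vs < suc q ^ r → q * length Es ≤ suc q * length Vs
edge-bound-acc q r {[]} {[]} _ _ _ _ = ≤-refl
edge-bound-acc q r {[]} {e ∷ Es} _ G _ _ with IsMultigraph.endpoints G (here refl)
... | () , _
edge-bound-acc q r {Vs@(v ∷ _)} {Es} (acc smaller) G girth small with sparse-ball q r G girth (here refl) small
... | j , sparse = begin
  q * length Es                      ≡⟨ cong (q *_) (length-filter-∁ (touches? j) Es) ⟨
  q * (length Fⱼ + length Es′)       ≡⟨ *-distribˡ-+ q (length Fⱼ) (length Es′) ⟩
  q * length Fⱼ + q * length Es′     ≤⟨ +-mono-≤ sparse rest ⟩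
  suc q * length Bⱼ + suc q * length Vs′ ≡⟨ *-distribˡ-+ (suc q) (length Bⱼ) (length Vs′) ⟨
  suc q * (length Bⱼ + length Vs′)   ≡⟨ cong (suc q *_) (length-filter-∁ (reach? j) Vs) ⟩
  suc q * length Vs                  ∎
  where
  open ≤-Reasoning
  open Balls Es v r using (reach?; touches?; reach-center)
  Bⱼ = filter (reach? j) Vs
  Fⱼ = filter (touches? j) Es
  Vs′ = filter (∁? (reach? j)) Vs
  Es′ = filter (∁? (touches? j)) Es
  shrinks : length Vs′ < length Vs
  shrinks = <-≤-trans (m<n+m (length Vs′) (filter-some (reach? j) (here (reach-center j))))
                      (≤-reflexive (length-filter-∁ (reach? j) Vs))
  rest : q * length Es′ ≤ suc q * length Vs′
  rest = edge-bound-acc q r (smaller shrinks) (delete-vertices (reach? j) G)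
           (girth ∘ ClosedTrail-mono (proj₁ ∘ ∈-filter⁻ (∁? (touches? j))))
           (≤-<-trans (*-monoʳ-≤ (q ^ r) (length-filter (∁? (reach? j)) Vs)) small)

edge-bound : ∀ q r {Vs Es} → IsMultigraph Vs Es → ClosedTrailsLongerThan (r + r) Es →
  q ^ r * length Vs < suc q ^ r → q * length Es ≤ suc q * length Vs
edge-bound q r {Vs} = edge-bound-acc q r (<-wellFounded (length Vs))

-- Elementary inequalities

^-distrib-* : ∀ m n k → (m * n) ^ k ≡ m ^ k * n ^ k
^-distrib-* m n zero = refl
^-distrib-* m n (suc k) = trans (cong (m * n *_) (^-distrib-* m n k)) (rearrange m n (m ^ k) (n ^ k))
  where
  rearrange : ∀ m n x y → m * n * (x * y) ≡ m * x * (n * y)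
  rearrange = solve-∀

n<2^n : ∀ n → n < 2 ^ n
n<2^n zero = s≤s z≤n
n<2^n (suc n) = begin-strict
  suc n         <⟨ s≤s (n<2^n n) ⟩
  1 + 2 ^ n     ≤⟨ +-monoˡ-≤ (2 ^ n) (m^n>0 2 n) ⟩
  2 ^ n + 2 ^ n ≡⟨ cong (2 ^ n +_) (+-identityʳ (2 ^ n)) ⟨
  2 ^ suc n     ∎
  where open ≤-Reasoning

-- Bernoulli's inequality (1 + 1/q)^n ≥ 1 + n/q, cleared of denominators
bernoulli : ∀ q n → q ^ n * (q + n) ≤ q * suc q ^ n
bernoulli q zero = ≤-reflexive (trans (+-identityʳ (q + 0)) (trans (+-identityʳ q) (sym (*-identityʳ q))))
bernoulli q (suc n) = begin
  q * q ^ n * (q + suc n)        ≡⟨ e₁ q (q ^ n) n ⟩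
  q ^ n * (q * (q + suc n))      ≤⟨ *-monoʳ-≤ (q ^ n) (m≤m+n (q * (q + suc n)) n) ⟩
  q ^ n * (q * (q + suc n) + n)  ≡⟨ e₂ q (q ^ n) n ⟩
  suc q * (q ^ n * (q + n))      ≤⟨ *-monoʳ-≤ (suc q) (bernoulli q n) ⟩
  suc q * (q * suc q ^ n)        ≡⟨ x∙yz≈y∙xz (suc q) q (suc q ^ n) ⟩
  q * (suc q * suc q ^ n)        ∎
  where
  open ≤-Reasoning
  e₁ : ∀ q x n → q * x * (q + suc n) ≡ x * (q * (q + suc n))
  e₁ = solve-∀
  e₂ : ∀ q x n → x * (q * (q + suc n) + n) ≡ suc q * (x * (q + n))
  e₂ = solve-∀

2*q^q≤[1+q]^q : ∀ q → 1 ≤ q → 2 * q ^ q ≤ suc q ^ q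
2*q^q≤[1+q]^q q@(suc _) _ = *-cancelˡ-≤ q (begin
  q * (2 * q ^ q) ≡⟨ e q (q ^ q) ⟩
  q ^ q * (q + q) ≤⟨ bernoulli q q ⟩
  q * suc q ^ q   ∎)
  where
  open ≤-Reasoning
  e : ∀ q x → q * (2 * x) ≡ x * (q + q)
  e = solve-∀

2^k*q^qk≤[1+q]^qk : ∀ q k → 1 ≤ q → 2 ^ k * q ^ (q * k) ≤ suc q ^ (q * k)
2^k*q^qk≤[1+q]^qk q k 1≤q = begin
  2 ^ k * q ^ (q * k)   ≡⟨ cong (2 ^ k *_) (^-*-assoc q q k) ⟨
  2 ^ k * (q ^ q) ^ k   ≡⟨ ^-distrib-* 2 (q ^ q) k ⟨
  (2 * q ^ q) ^ k       ≤⟨ ^-monoˡ-≤ k (2*q^q≤[1+q]^q q 1≤q) ⟩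
  (suc q ^ q) ^ k       ≡⟨ ^-*-assoc (suc q) q k ⟩
  suc q ^ (q * k)       ∎
  where open ≤-Reasoning

-- with t = ⌊j/m⌋ + 1 one has j ≤ m 2^t and t m ≤ m + j
j^m≤[2m]^m*2^j : ∀ m j → j ^ m ≤ (2 * m) ^ m * 2 ^ j
j^m≤[2m]^m*2^j zero j = ≤-trans (m^n>0 2 j) (≤-reflexive (sym (+-identityʳ (2 ^ j))))
j^m≤[2m]^m*2^j m@(suc _) j = begin
  j ^ m                     ≤⟨ ^-monoˡ-≤ m j≤m*2^t ⟩
  (m * 2 ^ t) ^ m           ≡⟨ ^-distrib-* m (2 ^ t) m ⟩
  m ^ m * (2 ^ t) ^ m       ≡⟨ cong (m ^ m *_) (^-*-assoc 2 t m) ⟩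
  m ^ m * 2 ^ (t * m)       ≤⟨ *-monoʳ-≤ (m ^ m) (^-monoʳ-≤ 2 (+-monoʳ-≤ m (m/n*n≤m j m))) ⟩
  m ^ m * 2 ^ (m + j)       ≡⟨ cong (m ^ m *_) (^-distribˡ-+-* 2 m j) ⟩
  m ^ m * (2 ^ m * 2 ^ j)   ≡⟨ x∙yz≈y∙xz (m ^ m) (2 ^ m) (2 ^ j) ⟩
  2 ^ m * (m ^ m * 2 ^ j)   ≡⟨ *-assoc (2 ^ m) (m ^ m) (2 ^ j) ⟨
  2 ^ m * m ^ m * 2 ^ j     ≡⟨ cong (_* 2 ^ j) (^-distrib-* 2 m m) ⟨
  (2 * m) ^ m * 2 ^ j       ∎
  where
  open ≤-Reasoning
  t = suc (j / m)
  j≤m*t : j ≤ m * t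
  j≤m*t = begin
    j                  ≡⟨ m≡m%n+[m/n]*n j m ⟩
    j % m + j / m * m  ≤⟨ +-monoˡ-≤ (j / m * m) (<⇒≤ (m%n<n j m)) ⟩
    m + j / m * m      ≡⟨ cong (m +_) (*-comm (j / m) m) ⟩
    m + m * (j / m)    ≡⟨ *-suc m (j / m) ⟨
    m * t              ∎
  j≤m*2^t : j ≤ m * 2 ^ t
  j≤m*2^t = ≤-trans j≤m*t (*-monoʳ-≤ m (<⇒≤ (n<2^n t)))

at : List Edge → ℕ → Edge
at [] _ = edge 0 0 0
at (s ∷ ss) zero = s
at (s ∷ ss) (suc j) = at ss j

at-∈ : ∀ ss {j} → j < length ss → at ss j ∈ ss
at-∈ (s ∷ ss) {zero} _ = here refl
at-∈ (s ∷ ss) {suc j} (s≤s j<) = there (at-∈ ss j<)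

walk-at-first : ∀ {x z} ss → Walk x ss z → 1 ≤ length ss → src (at ss 0) ≡ x
walk-at-first (s ∷ ss) (src≡x , _) _ = src≡x

walk-at-link : ∀ {x z} ss → Walk x ss z → ∀ {j} → suc j < length ss → dst (at ss j) ≡ src (at ss (suc j))
walk-at-link (s ∷ s′ ∷ ss) (_ , src′≡ , _) {zero} _ = sym src′≡
walk-at-link (s ∷ ss) (_ , w) {suc j} (s≤s 1+j<) = walk-at-link ss w 1+j<

walk-at-last : ∀ {x z} ss → Walk x ss z → ∀ {j} → suc j ≡ length ss → dst (at ss j) ≡ z
walk-at-last (s ∷ []) (_ , dst≡z) {zero} _ = dst≡z
walk-at-last (s ∷ ss@(_ ∷ _)) (_ , w) {suc j} eq = walk-at-last ss w (suc-injective eq)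

at-label-injective : ∀ ss → Unique (map label ss) → ∀ {j j′} → j < length ss → j′ < length ss →
  label (at ss j) ≡ label (at ss j′) → j ≡ j′
at-label-injective (s ∷ ss) u {zero} {zero} _ _ _ = refl
at-label-injective (s ∷ ss) (s∉ ∷ _) {zero} {suc j′} _ (s≤s j′<) eq = ⊥-elim (All.lookup s∉ (∈-map⁺ label (at-∈ ss j′<)) eq)
at-label-injective (s ∷ ss) (s∉ ∷ _) {suc j} {zero} (s≤s j<) _ eq = ⊥-elim (All.lookup s∉ (∈-map⁺ label (at-∈ ss j<)) (sym eq))
at-label-injective (s ∷ ss) (_ ∷ u) {suc j} {suc j′} (s≤s j<) (s≤s j′<) eq = cong suc (at-label-injective ss u j< j′< eq)

-- The prime factorization graph

prime⇒2≤ : ∀ {p} → Prime p → 2 ≤ p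
prime⇒2≤ {p} prime-p = nonTrivial⇒n>1 p {{prime⇒nonTrivial prime-p}}

large-primes-exceed : ∀ {N p u m} → Plarge N p → Plarge N u → p ≢ u → p ∣ m → u ∣ m → 1 ≤ m → ¬ m ≤ N
large-primes-exceed {N} {p} {u} (prime-p , N<p² , _) (prime-u , N<u² , _) p≢u p∣m (divides c refl) 1≤m m≤N
  with euclidsLemma c u prime-p p∣m
... | inj₂ p∣u with prime⇒irreducible prime-u p∣u
...   | inj₁ refl = <⇒≢ (prime⇒2≤ prime-p) refl
...   | inj₂ p≡u = p≢u p≡u
large-primes-exceed {N} {p} {u} (prime-p , N<p² , _) (prime-u , N<u² , _) p≢u p∣m (divides c refl) 1≤m m≤N
  | inj₁ p∣c = <⇒≱ (*-mono-< N<p² N<u²) (begin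
    p ^ 2 * u ^ 2  ≡⟨ ^-distrib-* p u 2 ⟨
    (p * u) ^ 2    ≤⟨ ^-monoˡ-≤ 2 pu≤N ⟩
    N ^ 2          ≡⟨ cong (N *_) (*-identityʳ N) ⟩
    N * N          ∎)
  where
  open ≤-Reasoning
  c≢0 : c ≢ 0
  c≢0 refl = <⇒≱ 1≤m z≤n
  pu≤N : p * u ≤ N
  pu≤N = ≤-trans (*-monoˡ-≤ u (∣⇒≤ {{≢-nonZero c≢0}} p∣c)) m≤N

SmallVertex : ℕ → ℕ → Set
SmallVertex N u = u ≡ 1 ⊎ Pmed N u

small≢large : ∀ {N u p} → SmallVertex N u → Plarge N p → u ≢ p
small≢large (inj₁ refl) (prime-p , _) refl = <⇒≢ (prime⇒2≤ prime-p) refl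
small≢large (inj₂ (_ , _ , u²≤N)) (_ , N<u² , _) refl = <⇒≱ N<u² u²≤N

neighbour-of-large : ∀ {N n} {A : Fin n → ℕ} → (∀ i → 1 ≤ A i × A i ≤ N) →
  ∀ {p u} → Plarge N p → Adj N A p u → SmallVertex N u
neighbour-of-large _ (prime-p , _) (inj₁ (p≡1 , _)) = ⊥-elim (<⇒≢ (prime⇒2≤ prime-p) (sym p≡1))
neighbour-of-large _ _ (inj₂ (inj₁ (u≡1 , _))) = inj₁ u≡1
neighbour-of-large _ _ (inj₂ (inj₂ (_ , inj₂ med , _))) = inj₂ med
neighbour-of-large bounds large (inj₂ (inj₂ (_ , inj₁ large′ , p≢u , i , p∣ , u∣))) =
  ⊥-elim (large-primes-exceed large large′ p≢u p∣ u∣ (proj₁ (bounds i)) (proj₂ (bounds i)))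

swap₁₂ : ℕ → ℕ
swap₁₂ 1 = 2
swap₁₂ 2 = 1
swap₁₂ n = n

swap₁₂-involutive : ∀ n → swap₁₂ (swap₁₂ n) ≡ n
swap₁₂-involutive 0 = refl
swap₁₂-involutive 1 = refl
swap₁₂-involutive 2 = refl
swap₁₂-involutive (suc (suc (suc n))) = refl

swap₁₂-injective : ∀ {m n} → swap₁₂ m ≡ swap₁₂ n → m ≡ n
swap₁₂-injective {m} {n} eq = trans (sym (swap₁₂-involutive m)) (trans (cong swap₁₂ eq) (swap₁₂-involutive n))

prime∧square≤? : ∀ N p → Dec (Prime p × p ^ 2 ≤ N)
prime∧square≤? N p = prime? p ×-dec (p ^ 2 ≤? N)

primesUpToSqrt : ℕ → List ℕ
primesUpToSqrt N = filter (prime∧square≤? N) (upTo (suc N))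

-- the prime 2 stands in for the vertex 1; for N ≥ 8 it is not a medium prime
smallVertices : ℕ → List ℕ
smallVertices N = map swap₁₂ (primesUpToSqrt N)

smallVertices-unique : ∀ N → Unique (smallVertices N)
smallVertices-unique N = Unique.map⁺ swap₁₂-injective (Unique.filter⁺ (prime∧square≤? N) (Unique.upTo⁺ (suc N)))

∈-primesUpToSqrt : ∀ {N p} → Prime p → p ^ 2 ≤ N → p ∈ primesUpToSqrt N
∈-primesUpToSqrt {N} {p} prime-p p²≤N = ∈-filter⁺ (prime∧square≤? N)
  (∈-upTo⁺ (s≤s (≤-trans (m≤m*n p (p * 1) {{p*1-nonZero}}) p²≤N)))
  (prime-p , p²≤N)
  where
  p*1-nonZero : NonZero (p * 1)
  p*1-nonZero = >-nonZero (<-≤-trans (s≤s z≤n) (≤-trans (prime⇒2≤ prime-p) (≤-reflexive (sym (*-identityʳ p)))))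

small-vertex∈ : ∀ {N u} → 8 ≤ N → SmallVertex N u → u ∈ smallVertices N
small-vertex∈ 8≤N (inj₁ refl) = ∈-map⁺ swap₁₂ (∈-primesUpToSqrt prime[2] (≤-trans (+-monoʳ-≤ 4 z≤n) 8≤N))
small-vertex∈ {N} {u} 8≤N (inj₂ (prime-u , N<u³ , u²≤N)) = subst (_∈ smallVertices N) (fixed u (prime⇒2≤ prime-u) u≢2)
  (∈-map⁺ swap₁₂ (∈-primesUpToSqrt prime-u u²≤N))
  where
  u≢2 : u ≢ 2
  u≢2 refl = <⇒≱ N<u³ 8≤N
  fixed : ∀ u → 2 ≤ u → u ≢ 2 → swap₁₂ u ≡ u
  fixed 1 (s≤s ()) _
  fixed 2 _ u≢2 = ⊥-elim (u≢2 refl)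
  fixed (suc (suc (suc _))) _ _ = refl

adj-sym : ∀ {N n} {A : Fin n → ℕ} {u w} → Adj N A u w → Adj N A w u
adj-sym (inj₁ edge₁) = inj₂ (inj₁ edge₁)
adj-sym (inj₂ (inj₁ edge₁)) = inj₁ edge₁
adj-sym (inj₂ (inj₂ (pu , pw , u≢w , i , u∣ , w∣))) = inj₂ (inj₂ (pw , pu , u≢w ∘ sym , i , w∣ , u∣))

SamePair-resp : ∀ {a b c d a′ b′ c′ d′} → a ≡ a′ → b ≡ b′ → c ≡ c′ → d ≡ d′ → SamePair a b c d → SamePair a′ b′ c′ d′
SamePair-resp refl refl refl refl same = same

half-< : ∀ {j ℓ} → j + j < ℓ + ℓ → j < ℓ
half-< {j} {ℓ} lt = ≰⇒> λ ℓ≤j → <⇒≱ lt (+-mono-≤ ℓ≤j ℓ≤j)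

module FactorizationGraph (N : ℕ) {n : ℕ} (A : Fin n → ℕ) (bounds : ∀ i → 1 ≤ A i × A i ≤ N) where

  -- the edge labelled p from u to w records the path u – p – w of G(A) through the large prime p
  record Spoke (s : Edge) : Set where
    field
      large : Plarge N (label s)
      adj-src : Adj N A (label s) (src s)
      adj-dst : Adj N A (label s) (dst s)
      distinct : src s ≢ dst s

    small-src : SmallVertex N (src s)
    small-src = neighbour-of-large bounds large adj-src

    small-dst : SmallVertex N (dst s)
    small-dst = neighbour-of-large bounds large adj-dst

  Spoke-opposite : ∀ {s} → Spoke s → Spoke (opposite s)
  Spoke-opposite σ = record { large = large ; adj-src = adj-dst ; adj-dst = adj-src ; distinct = distinct ∘ sym }
    where open Spoke σ

  spokes : (S : List ℕ) → All (LargeDeg2 N A) S → List Edge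
  spokes [] [] = []
  spokes (p ∷ S) ((_ , u , w , _) ∷ degrees) = edge p u w ∷ spokes S degrees

  labels-spokes : ∀ S degrees → map label (spokes S degrees) ≡ S
  labels-spokes [] [] = refl
  labels-spokes (p ∷ S) (_ ∷ degrees) = cong (p ∷_) (labels-spokes S degrees)

  spokes-are-Spokes : ∀ S degrees {e} → e ∈ spokes S degrees → Spoke e
  spokes-are-Spokes (p ∷ S) ((large , u , w , u≢w , adj-u , adj-w) ∷ _) (here refl) = record
    { large = large ; adj-src = adj-u ; adj-dst = adj-w ; distinct = u≢w }
  spokes-are-Spokes (p ∷ S) (_ ∷ degrees) (there e∈) = spokes-are-Spokes S degrees e∈

  spokes-multigraph : 8 ≤ N → ∀ {S} → Unique S → (degrees : All (LargeDeg2 N A) S) →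
    IsMultigraph (smallVertices N) (spokes S degrees)
  spokes-multigraph 8≤N {S} unique-S degrees = record
    { vertices-distinct = smallVertices-unique N
    ; endpoints = λ e∈ → let σ = spokes-are-Spokes S degrees e∈ in
        small-vertex∈ 8≤N (Spoke.small-src σ) , small-vertex∈ 8≤N (Spoke.small-dst σ)
    ; loopless = Spoke.distinct ∘ spokes-are-Spokes S degrees
    ; labels-distinct = subst Unique (sym (labels-spokes S degrees)) unique-S
    }

  module TrailCircuit {ss : List Edge} {ℓ′ : ℕ} (length≡ : length ss ≡ suc ℓ′) {x : ℕ} (closed : Walk x ss x)
                      (labels-distinct : Unique (map label ss)) (spoke : ∀ {s} → s ∈ ss → Spoke s) where

    ℓ : ℕ
    ℓ = suc ℓ′

    X P Y : ℕ → ℕ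
    X j = src (at ss j)
    P j = label (at ss j)
    Y j = dst (at ss j)

    -- the circuit X 0, P 0, X 1, P 1, …, X ℓ′, P ℓ′ of G(A)
    v : ℕ → ℕ
    v = interleave X P

    next : ℕ → ℕ
    next i = v (suc i % (ℓ + ℓ))

    spoke-at : ∀ {j} → j < ℓ → Spoke (at ss j)
    spoke-at j< = spoke (at-∈ ss (subst (_ <_) (sym length≡) j<))

    P-injective : ∀ {j j′} → j < ℓ → j′ < ℓ → P j ≡ P j′ → j ≡ j′
    P-injective j< j′< = at-label-injective ss labels-distinct (subst (_ <_) (sym length≡) j<) (subst (_ <_) (sym length≡) j′<)

    next-even : ∀ {j} → j < ℓ → next (j + j) ≡ P j
    next-even {j} j< = trans (cong v (m<n⇒m%n≡m (subst (_≤ ℓ + ℓ) (cong suc (+-suc j j)) (+-mono-≤ j< j<))))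
                             (interleave-odd X P j)

    next-odd : ∀ {j} → j < ℓ → next (suc (j + j)) ≡ Y j
    next-odd {j} j< with suc j <? ℓ
    ... | yes 1+j< = begin
      v (suc (suc (j + j)) % (ℓ + ℓ)) ≡⟨ cong v (m<n⇒m%n≡m (subst (_< ℓ + ℓ) 2+2j≡ (+-mono-< 1+j< 1+j<))) ⟩
      v (suc (suc (j + j)))           ≡⟨ cong v 2+2j≡ ⟨
      v (suc j + suc j)               ≡⟨ interleave-even X P (suc j) ⟩
      X (suc j)                       ≡⟨ walk-at-link ss closed (subst (_ <_) (sym length≡) 1+j<) ⟨
      Y j                             ∎
      where
      open ≡-Reasoning
      2+2j≡ : suc j + suc j ≡ suc (suc (j + j))
      2+2j≡ = cong suc (+-suc j j)
    ... | no 1+j≮ℓ = begin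
      v (suc (suc (j + j)) % (ℓ + ℓ)) ≡⟨ cong (λ m → v (m % (ℓ + ℓ))) (trans (cong suc (sym (+-suc j j))) (cong (λ m → m + m) 1+j≡ℓ)) ⟩
      v ((ℓ + ℓ) % (ℓ + ℓ))           ≡⟨ cong v (n%n≡0 (ℓ + ℓ)) ⟩
      X 0                             ≡⟨ walk-at-first ss closed (subst (1 ≤_) (sym length≡) (s≤s z≤n)) ⟩
      x                               ≡⟨ walk-at-last ss closed (trans 1+j≡ℓ (sym length≡)) ⟨
      Y j                             ∎
      where
      open ≡-Reasoning
      1+j≡ℓ : suc j ≡ ℓ
      1+j≡ℓ = ≤-antisym j< (≮⇒≥ 1+j≮ℓ)

    CircuitEdge : ℕ → Set
    CircuitEdge i = ∃[ j ] j < ℓ × ((i ≡ j + j × v i ≡ X j × next i ≡ P j) ⊎ (i ≡ suc (j + j) × v i ≡ P j × next i ≡ Y j))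

    circuit-edge : ∀ i → i < ℓ + ℓ → CircuitEdge i
    circuit-edge i i< with even⊎odd i
    ... | j , inj₁ refl = j , half-< i< , inj₁ (refl , interleave-even X P j , next-even (half-< i<))
    ... | j , inj₂ refl = j , j< , inj₂ (refl , interleave-odd X P j , next-odd j<)
      where
      j< : j < ℓ
      j< = half-< (<-trans (n<1+n (j + j)) i<)

    small-X : ∀ {j} → j < ℓ → SmallVertex N (X j)
    small-X = Spoke.small-src ∘ spoke-at
    small-Y : ∀ {j} → j < ℓ → SmallVertex N (Y j)
    small-Y = Spoke.small-dst ∘ spoke-at
    large-P : ∀ {j} → j < ℓ → Plarge N (P j)
    large-P = Spoke.large ∘ spoke-at

    adjacent : ∀ i → i < ℓ + ℓ → Adj N A (v i) (next i)
    adjacent i i< with circuit-edge i i<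
    ... | j , j< , inj₁ (_ , vi≡ , next≡) = subst₂ (Adj N A) (sym vi≡) (sym next≡) (adj-sym (Spoke.adj-src (spoke-at j<)))
    ... | j , j< , inj₂ (_ , vi≡ , next≡) = subst₂ (Adj N A) (sym vi≡) (sym next≡) (Spoke.adj-dst (spoke-at j<))

    -- labels are large primes and the other endpoints are not, so equal circuit edges share their step j
    distinct : ∀ i i′ → i < ℓ + ℓ → i′ < ℓ + ℓ → i ≢ i′ → ¬ SamePair (v i) (next i) (v i′) (next i′)
    distinct i i′ i< i′< i≢i′ same with circuit-edge i i< | circuit-edge i′ i′<
    ... | j , j< , inj₁ (refl , vi , ni) | j′ , j′< , inj₁ (refl , vi′ , ni′) with SamePair-resp vi ni vi′ ni′ same
    ...   | inj₁ (_ , Pj≡Pj′) = i≢i′ (cong (λ m → m + m) (P-injective j< j′< Pj≡Pj′))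
    ...   | inj₂ (Xj≡Pj′ , _) = small≢large (small-X j<) (large-P j′<) Xj≡Pj′
    distinct i i′ i< i′< i≢i′ same | j , j< , inj₁ (refl , vi , ni) | j′ , j′< , inj₂ (refl , vi′ , ni′) with SamePair-resp vi ni vi′ ni′ same
    ...   | inj₁ (Xj≡Pj′ , _) = small≢large (small-X j<) (large-P j′<) Xj≡Pj′
    ...   | inj₂ (Xj≡Yj′ , Pj≡Pj′) with P-injective j< j′< Pj≡Pj′
    ...     | refl = Spoke.distinct (spoke-at j<) Xj≡Yj′
    distinct i i′ i< i′< i≢i′ same | j , j< , inj₂ (refl , vi , ni) | j′ , j′< , inj₁ (refl , vi′ , ni′) with SamePair-resp vi ni vi′ ni′ same
    ...   | inj₁ (Pj≡Xj′ , _) = small≢large (small-X j′<) (large-P j<) (sym Pj≡Xj′)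
    ...   | inj₂ (Pj≡Pj′ , Yj≡Xj′) with P-injective j< j′< Pj≡Pj′
    ...     | refl = Spoke.distinct (spoke-at j<) (sym Yj≡Xj′)
    distinct i i′ i< i′< i≢i′ same | j , j< , inj₂ (refl , vi , ni) | j′ , j′< , inj₂ (refl , vi′ , ni′) with SamePair-resp vi ni vi′ ni′ same
    ...   | inj₁ (Pj≡Pj′ , _) = i≢i′ (cong (λ m → suc (m + m)) (P-injective j< j′< Pj≡Pj′))
    ...   | inj₂ (Pj≡Yj′ , _) = small≢large (small-Y j′<) (large-P j<) (sym Pj≡Yj′)

    circuit : Circuit N A (ℓ′ + ℓ) v
    circuit = adjacent , distinct

  ∈ᵘ-spokes : ∀ S degrees {s} → s ∈ᵘ spokes S degrees → Spoke s
  ∈ᵘ-spokes S degrees (inj₁ s∈) = spokes-are-Spokes S degrees s∈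
  ∈ᵘ-spokes S degrees (inj₂ s∈) = Spoke-opposite (spokes-are-Spokes S degrees s∈)

  spokes-girth : NoShortEvenCircuit N A → ∀ {S} (degrees : All (LargeDeg2 N A) S) →
    ∀ {L} → L ^ 12 ≤ N → ClosedTrailsLongerThan L (spokes S degrees)
  spokes-girth no-circuit {S} degrees {L} L¹²≤N {ss} trail with length ss in length≡ | ClosedTrail.nonempty trail
  ... | suc ℓ′ | _ = ≰⇒> λ ℓ≤L → no-circuit (ℓ′ + ℓ) v circuit ℓ (cong (ℓ +_) (sym (+-identityʳ ℓ))) (begin
    (ℓ + ℓ) ^ 12       ≡⟨ cong (_^ 12) (cong (ℓ +_) (+-identityʳ ℓ)) ⟨
    (2 * ℓ) ^ 12       ≡⟨ ^-distrib-* 2 ℓ 12 ⟩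
    2 ^ 12 * ℓ ^ 12    ≤⟨ *-monoʳ-≤ (2 ^ 12) (≤-trans (^-monoˡ-≤ 12 ℓ≤L) L¹²≤N) ⟩
    2 ^ 12 * N         ∎)
    where
    open ClosedTrail trail
    open TrailCircuit length≡ closed labels-distinct (∈ᵘ-spokes S degrees ∘ All.lookup along)
    open ≤-Reasoning

large-degree-two-bound : ∀ {N n} (A : Fin n → ℕ) → (∀ i → 1 ≤ A i × A i ≤ N) → NoShortEvenCircuit N A →
  ∀ {S} → Unique S → All (LargeDeg2 N A) S →
  ∀ {q k} → 1 ≤ q → 1 ≤ k → (2 * q * k) ^ 12 ≤ N → piSqrt N < 2 ^ k → q * length S ≤ suc q * piSqrt N
large-degree-two-bound {N} A bounds no-circuit {S} unique-S degrees {q} {k} 1≤q 1≤k [2qk]¹²≤N π<2^k =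
  subst₂ (λ e v → q * e ≤ suc q * v) length-spokes (length-map swap₁₂ (primesUpToSqrt N))
    (edge-bound q r (spokes-multigraph 8≤N unique-S degrees) (spokes-girth no-circuit degrees [r+r]¹²≤N) sparse-enough)
  where
  open FactorizationGraph N A bounds
  r = q * k
  r+r≡2qk : r + r ≡ 2 * q * k
  r+r≡2qk = trans (cong (r +_) (sym (+-identityʳ r))) (sym (*-assoc 2 q k))
  [r+r]¹²≤N : (r + r) ^ 12 ≤ N
  [r+r]¹²≤N = subst (λ m → m ^ 12 ≤ N) (sym r+r≡2qk) [2qk]¹²≤N
  8≤N : 8 ≤ N
  8≤N = ≤-trans (m≤m+n 8 4088) (≤-trans (^-monoˡ-≤ 12 (*-mono-≤ (*-monoʳ-≤ 2 1≤q) 1≤k)) [2qk]¹²≤N)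
  length-spokes : length (spokes S degrees) ≡ length S
  length-spokes = trans (sym (length-map label (spokes S degrees))) (cong length (labels-spokes S degrees))
  sparse-enough : q ^ r * length (smallVertices N) < suc q ^ r
  sparse-enough = begin-strict
    q ^ r * length (smallVertices N)  ≡⟨ cong (q ^ r *_) (length-map swap₁₂ (primesUpToSqrt N)) ⟩
    q ^ r * piSqrt N                  <⟨ *-monoʳ-< (q ^ r) {{m^n≢0 q r {{>-nonZero 1≤q}}}} π<2^k ⟩
    q ^ r * 2 ^ k                     ≡⟨ *-comm (q ^ r) (2 ^ k) ⟩
    2 ^ k * q ^ r                     ≤⟨ 2^k*q^qk≤[1+q]^qk q k 1≤q ⟩
    suc q ^ r                         ∎
    where open ≤-Reasoning

-- Choice of the parameters

-- opaque, so that the type checker never unfolds multiplication by these huge literals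
opaque
  [2*13]^13 : ℕ
  [2*13]^13 = (2 * 13) ^ 13

  [2*13]^13-unfold : (2 * 13) ^ 13 ≡ [2*13]^13
  [2*13]^13-unfold = refl

  K₀ : ℕ
  K₀ = [2*13]^13 * 2 ^ 13

  K₀-unfold : [2*13]^13 * 2 ^ 13 ≡ K₀
  K₀-unfold = refl

k≤K₀ : ∀ {N k} → 1 ≤ k → 2 ^ k ≤ 2 * suc N → N < (2 * k) ^ 12 → k ≤ K₀
k≤K₀ {N} {k} 1≤k 2^k≤ N< = *-cancelʳ-≤ k K₀ (k ^ 12) {{m^n≢0 k 12 {{>-nonZero 1≤k}}}} (begin
  k * k ^ 12                           ≤⟨ subst (λ c → k * k ^ 12 ≤ c * 2 ^ k) [2*13]^13-unfold (j^m≤[2m]^m*2^j 13 k) ⟩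
  [2*13]^13 * 2 ^ k                    ≤⟨ *-monoʳ-≤ [2*13]^13 (≤-trans 2^k≤ (*-monoʳ-≤ 2 N<)) ⟩
  [2*13]^13 * (2 * (2 * k) ^ 12)       ≡⟨ cong (λ y → [2*13]^13 * (2 * y)) (^-distrib-* 2 k 12) ⟩
  [2*13]^13 * (2 * (2 ^ 12 * k ^ 12))  ≡⟨ cong ([2*13]^13 *_) (*-assoc 2 (2 ^ 12) (k ^ 12)) ⟨
  [2*13]^13 * (2 ^ 13 * k ^ 12)        ≡⟨ *-assoc [2*13]^13 (2 ^ 13) (k ^ 12) ⟨
  [2*13]^13 * 2 ^ 13 * k ^ 12          ≡⟨ cong (_* k ^ 12) K₀-unfold ⟩
  K₀ * k ^ 12                          ∎)
  where open ≤-Reasoning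

N₀ : ℕ
N₀ = (2 * K₀) ^ 12

C : ℕ → ℕ
C b = 32 * suc b + N₀ * N₀

^-12 : ∀ x m → (x ^ m) ^ 12 ≡ x ^ (12 * m)
^-12 x m = trans (^-*-assoc x m 12) (cong (x ^_) (*-comm m 12))

2*[1+n]≤4*n : ∀ {n} → 1 ≤ n → 2 * suc n ≤ 4 * n
2*[1+n]≤4*n {n} 1≤n = begin
  2 * suc n      ≡⟨ *-suc 2 n ⟩
  2 + 2 * n      ≤⟨ +-monoˡ-≤ (2 * n) (*-monoʳ-≤ 2 1≤n) ⟩
  2 * n + 2 * n  ≡⟨ e n ⟩
  4 * n          ∎
  where
  open ≤-Reasoning
  e : ∀ n → 2 * n + 2 * n ≡ 4 * n
  e = solve-∀

[4k]^m≤C^m*N^[a+1] : ∀ a b {N k} → 1 ≤ N → 2 ^ k ≤ 2 * suc N → (4 * k) ^ suc b ≤ C b ^ suc b * N ^ suc a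
[4k]^m≤C^m*N^[a+1] a b {N} {k} 1≤N 2^k≤ = begin
  (4 * k) ^ m                          ≡⟨ ^-distrib-* 4 k m ⟩
  4 ^ m * k ^ m                        ≤⟨ *-monoʳ-≤ (4 ^ m) (j^m≤[2m]^m*2^j m k) ⟩
  4 ^ m * ((2 * m) ^ m * 2 ^ k)        ≤⟨ *-monoʳ-≤ (4 ^ m) (*-monoʳ-≤ ((2 * m) ^ m) (≤-trans 2^k≤ (2*[1+n]≤4*n 1≤N))) ⟩
  4 ^ m * ((2 * m) ^ m * (4 * N))      ≡⟨ e₁ (4 ^ m) ((2 * m) ^ m) N ⟩
  4 ^ m * (2 * m) ^ m * 4 * N          ≤⟨ *-monoˡ-≤ N (*-monoʳ-≤ (4 ^ m * (2 * m) ^ m) (*-monoʳ-≤ 4 (m^n>0 4 b))) ⟩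
  4 ^ m * (2 * m) ^ m * 4 ^ m * N      ≡⟨ cong (_* N) e₂ ⟩
  (32 * m) ^ m * N                     ≤⟨ *-mono-≤ (^-monoˡ-≤ m (m≤m+n (32 * m) (N₀ * N₀))) N≤N^[a+1] ⟩
  C b ^ m * N ^ suc a                  ∎
  where
  open ≤-Reasoning
  m = suc b
  N≤N^[a+1] : N ≤ N ^ suc a
  N≤N^[a+1] = subst (_≤ N ^ suc a) (*-identityʳ N) (*-monoʳ-≤ N (m^n>0 N {{>-nonZero 1≤N}} a))
  e₁ : ∀ x y N → x * (y * (4 * N)) ≡ x * y * 4 * N
  e₁ = solve-∀
  e₂ : 4 ^ m * (2 * m) ^ m * 4 ^ m ≡ (32 * m) ^ m
  e₂ = begin-equality
    4 ^ m * (2 * m) ^ m * 4 ^ m  ≡⟨ cong (_* 4 ^ m) (^-distrib-* 4 (2 * m) m) ⟨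
    (4 * (2 * m)) ^ m * 4 ^ m    ≡⟨ ^-distrib-* (4 * (2 * m)) 4 m ⟨
    (4 * (2 * m) * 4) ^ m        ≡⟨ cong (_^ m) (e₃ m) ⟩
    (32 * m) ^ m                 ∎
    where
    e₃ : ∀ m → 4 * (2 * m) * 4 ≡ 32 * m
    e₃ = solve-∀

-- N < (4qk)^12 and x ≤ π/q, so x ≤ 4k π N^(-1/12)
excess-bound-dense : ∀ a b {N q k x π} → 1 ≤ q → 1 ≤ N → q * x ≤ π → N < (2 * suc q * k) ^ 12 → 2 ^ k ≤ 2 * suc N →
  x ^ (12 * suc b) * N ^ suc b ≤ (C b * π) ^ (12 * suc b) * N ^ (12 * suc a)
excess-bound-dense a b {N} {q} {k} {x} {π} 1≤q 1≤N qx≤π N< 2^k≤ = begin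
  x ^ E * N ^ m                             ≤⟨ *-monoʳ-≤ (x ^ E) N^m≤ ⟩
  x ^ E * (4 * q * k) ^ E                   ≡⟨ ^-distrib-* x (4 * q * k) E ⟨
  (x * (4 * q * k)) ^ E                     ≡⟨ cong (_^ E) (e₁ x q k) ⟩
  (q * x * (4 * k)) ^ E                     ≤⟨ ^-monoˡ-≤ E (*-monoˡ-≤ (4 * k) qx≤π) ⟩
  (π * (4 * k)) ^ E                         ≡⟨ ^-distrib-* π (4 * k) E ⟩
  π ^ E * (4 * k) ^ E                       ≤⟨ *-monoʳ-≤ (π ^ E) [4k]^E≤ ⟩
  π ^ E * (C b ^ E * N ^ (12 * suc a))      ≡⟨ x∙yz≈y∙xz (π ^ E) (C b ^ E) _ ⟩
  C b ^ E * (π ^ E * N ^ (12 * suc a))      ≡⟨ *-assoc (C b ^ E) (π ^ E) _ ⟨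
  C b ^ E * π ^ E * N ^ (12 * suc a)        ≡⟨ cong (_* N ^ (12 * suc a)) (^-distrib-* (C b) π E) ⟨
  (C b * π) ^ E * N ^ (12 * suc a)          ∎
  where
  open ≤-Reasoning
  m = suc b
  E = 12 * suc b
  e₁ : ∀ x q k → x * (4 * q * k) ≡ q * x * (4 * k)
  e₁ = solve-∀
  N^m≤ : N ^ m ≤ (4 * q * k) ^ E
  N^m≤ = begin
    N ^ m                  ≤⟨ ^-monoˡ-≤ m (<⇒≤ N<) ⟩
    ((2 * suc q * k) ^ 12) ^ m ≤⟨ ^-monoˡ-≤ m (^-monoˡ-≤ 12 (*-monoˡ-≤ k (2*[1+n]≤4*n 1≤q))) ⟩
    ((4 * q * k) ^ 12) ^ m ≡⟨ ^-*-assoc (4 * q * k) 12 m ⟩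
    (4 * q * k) ^ E        ∎
  [4k]^E≤ : (4 * k) ^ E ≤ C b ^ E * N ^ (12 * suc a)
  [4k]^E≤ = begin
    (4 * k) ^ E                          ≡⟨ ^-12 (4 * k) m ⟨
    ((4 * k) ^ m) ^ 12                   ≤⟨ ^-monoˡ-≤ 12 ([4k]^m≤C^m*N^[a+1] a b {k = k} 1≤N 2^k≤) ⟩
    (C b ^ m * N ^ suc a) ^ 12           ≡⟨ ^-distrib-* (C b ^ m) (N ^ suc a) 12 ⟩
    (C b ^ m) ^ 12 * (N ^ suc a) ^ 12    ≡⟨ cong₂ _*_ (^-12 (C b) m) (^-12 N (suc a)) ⟩
    C b ^ E * N ^ (12 * suc a)           ∎

excess-bound-small : ∀ a b {N s π} → 1 ≤ N → 1 ≤ π → s ≤ suc N → suc N ≤ N₀ →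
  (s ∸ π) ^ (12 * suc b) * N ^ suc b ≤ (C b * π) ^ (12 * suc b) * N ^ (12 * suc a)
excess-bound-small a b {N} {s} {π} 1≤N 1≤π s≤ 1+N≤N₀ = begin
  (s ∸ π) ^ E * N ^ m               ≤⟨ *-mono-≤ (^-monoˡ-≤ E (≤-trans (m∸n≤m s π) (≤-trans s≤ 1+N≤N₀)))
                                                (≤-trans (^-monoˡ-≤ m (≤-trans (n≤1+n N) 1+N≤N₀)) (^-monoʳ-≤ N₀ {{>-nonZero 1≤N₀}} (m≤n*m m 12))) ⟩
  N₀ ^ E * N₀ ^ E                   ≡⟨ ^-distrib-* N₀ N₀ E ⟨
  (N₀ * N₀) ^ E                     ≤⟨ ^-monoˡ-≤ E (m≤n+m (N₀ * N₀) (32 * m)) ⟩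
  C b ^ E                           ≤⟨ m≤m*n (C b ^ E) (π ^ E) {{m^n≢0 π E {{>-nonZero 1≤π}}}} ⟩
  C b ^ E * π ^ E                   ≤⟨ m≤m*n (C b ^ E * π ^ E) (N ^ (12 * suc a)) {{m^n≢0 N (12 * suc a) {{>-nonZero 1≤N}}}} ⟩
  C b ^ E * π ^ E * N ^ (12 * suc a) ≡⟨ cong (_* N ^ (12 * suc a)) (^-distrib-* (C b) π E) ⟨
  (C b * π) ^ E * N ^ (12 * suc a)  ∎
  where
  open ≤-Reasoning
  m = suc b
  E = 12 * suc b
  1≤N₀ : 1 ≤ N₀
  1≤N₀ = ≤-trans (s≤s z≤n) 1+N≤N₀

excess-bound : ∀ a b {N s π} → 1 ≤ N → 1 ≤ π → π ≤ suc N → s ≤ suc N →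
  (∀ {q k} → 1 ≤ q → 1 ≤ k → (2 * q * k) ^ 12 ≤ N → π < 2 ^ k → q * s ≤ suc q * π) →
  (s ∸ π) ^ (12 * suc b) * N ^ suc b ≤ (C b * π) ^ (12 * suc b) * N ^ (12 * suc a)
excess-bound a b {N} {s} {π} 1≤N 1≤π π≤ s≤ moore with crossing (2 ^_) (suc N) (s≤s z≤n) (n<2^n (suc N))
... | j , 2^j≤1+N , 1+N<2^k with crossing (λ q → (2 * q * suc j) ^ 12) (suc N) z≤n N<
  where
  N< : N < (2 * suc N * suc j) ^ 12
  N< = ≤-trans (m≤n*m (suc N) 2) (≤-trans (m≤m*n (2 * suc N) (suc j)) (x≤x^[1+n] (2 * suc N * suc j) 11))
    where
    x≤x^[1+n] : ∀ x n .{{_ : NonZero x}} → x ≤ x ^ suc n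
    x≤x^[1+n] x n = subst (_≤ x ^ suc n) (*-identityʳ x) (*-monoʳ-≤ x (m^n>0 x n))
...   | zero , _ , N<[2k]¹² = excess-bound-small a b {N} {s} {π} 1≤N 1≤π s≤
  (≤-trans N<[2k]¹² (^-monoˡ-≤ 12 (*-monoʳ-≤ 2 (k≤K₀ {N} {suc j} (s≤s z≤n) (*-monoʳ-≤ 2 2^j≤1+N) N<[2k]¹²))))
...   | suc q′ , [2qk]¹²≤N , N< = excess-bound-dense a b {N} {q} {suc j} {s ∸ π} {π} (s≤s z≤n) 1≤N excess N< (*-monoʳ-≤ 2 2^j≤1+N)
  where
  q = suc q′
  excess : q * (s ∸ π) ≤ π
  excess = begin
    q * (s ∸ π)        ≡⟨ *-distribˡ-∸ q s π ⟩
    q * s ∸ q * π      ≤⟨ ∸-monoˡ-≤ (q * π) (moore {q} {suc j} (s≤s z≤n) (s≤s z≤n) [2qk]¹²≤N (≤-<-trans π≤ 1+N<2^k)) ⟩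
    suc q * π ∸ q * π  ≡⟨ m+n∸n≡m π (q * π) ⟩
    π                  ∎
    where open ≤-Reasoning

no-large-degree-two-below-4 : ∀ {N n} {A : Fin n → ℕ} → (∀ i → 1 ≤ A i × A i ≤ N) → N < 4 → ∀ {p} → ¬ LargeDeg2 N A p
no-large-degree-two-below-4 bounds N<4 (large , u , w , u≢w , adj-u , adj-w) =
  u≢w (trans (is-1 (neighbour-of-large bounds large adj-u)) (sym (is-1 (neighbour-of-large bounds large adj-w))))
  where
  is-1 : ∀ {u} → SmallVertex _ u → u ≡ 1
  is-1 (inj₁ u≡1) = u≡1
  is-1 (inj₂ (prime-u , _ , u²≤N)) = ⊥-elim (<⇒≱ N<4 (≤-trans (^-monoˡ-≤ 2 (prime⇒2≤ prime-u)) u²≤N))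

-- 0 ∸ π is stuck until π is known, as _∸_ recurses on its second argument
no-excess : ∀ {b y z} π → (0 ∸ π) ^ (12 * suc b) * y ≤ z
no-excess π rewrite 0∸n≡0 π = z≤n

large-degree-two-count : ∀ a b {N n} (A : Fin n → ℕ) → (∀ i → 1 ≤ A i × A i ≤ N) → NoShortEvenCircuit N A →
  ∀ S → Unique S → All (LargeDeg2 N A) S →
  (length S ∸ piSqrt N) ^ (12 * suc b) * N ^ suc b ≤ (C b * piSqrt N) ^ (12 * suc b) * N ^ (12 * suc a)
large-degree-two-count a b {N} A bounds no-circuit [] _ _ = no-excess {b} (piSqrt N)
large-degree-two-count a b {N} A bounds no-circuit S@(_ ∷ _) unique-S degrees@(deg₀ ∷ _) with N <? 4
... | yes N<4 = ⊥-elim (no-large-degree-two-below-4 bounds N<4 deg₀)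
... | no N≮4 = excess-bound a b (≤-trans (s≤s z≤n) (≮⇒≥ N≮4)) 1≤π π≤ s≤
                 (large-degree-two-bound A bounds no-circuit unique-S degrees)
  where
  1≤π : 1 ≤ piSqrt N
  1≤π = filter-some (prime∧square≤? N) (lose (∈-upTo⁺ (s≤s (≤-trans (s≤s (s≤s z≤n)) (≮⇒≥ N≮4)))) (prime[2] , ≮⇒≥ N≮4))
  π≤ : piSqrt N ≤ suc N
  π≤ = ≤-trans (length-filter (prime∧square≤? N) (upTo (suc N))) (≤-reflexive (length-upTo (suc N)))
  s≤ : length S ≤ suc N
  s≤ = ≤-trans (Unique⇒length-mono _≟_ unique-S λ p∈ → ∈-upTo⁺ (s≤s (proj₂ (proj₂ (proj₁ (All.lookup degrees p∈))))))
               (≤-reflexive (length-upTo (suc N)))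

-- ε = (a+1)/(b+1), and |S| ≤ (1 + C N^(ε-1/12)) π(N^(1/2)) is raised to the power 12(b+1).
lemma4p2 : ∀ (a b : ℕ) → ∃[ C ] ∀ (N n : ℕ) (A : Fin n → ℕ) →
    Injective _≡_ _≡_ A →
    (∀ i → 1 ≤ A i × A i ≤ N) →
    DistinctSubsetProducts A →
    (∀ i j → (∀ p → PLM N p → V p (A i) ≡ V p (A j)) → A i ≡ A j) →
    (∀ i → ∃[ p ] (PLM N p × V p (A i) ≢ 0)) →
    NoShortEvenCircuit N A →
    ∀ (S : List ℕ) → Unique S → All (LargeDeg2 N A) S →
    (length S ∸ piSqrt N) ^ (12 * suc b) * N ^ suc b
      ≤ (C * piSqrt N) ^ (12 * suc b) * N ^ (12 * suc a)
lemma4p2 a b = C b , λ N n A _ bounds _ _ _ no-circuit → large-degree-two-count a b A bounds no-circuit
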